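{- Let $G$ and $H$ be (uncolored) graphs. Then Duplicator has a winning strategy for $\operatorname{BP}_{(0,2)}(G,H)$ if and only if the degree sequences of $G$ and $H$ coincide, and Duplicator has a winning strategy for $\operatorname{BP}_{(1,1)}(G,H)$ if and only if the neighborhood-degree sequences of $G$ and $H$ coincide.
   Context: The degree sequence of $G$ is the multiset $\{\!\!\{d_G(v):v\in V(G)\}\!\!\}$ and the neighborhood-degree sequence is the multiset $\{\!\!\{\{\!\!\{d_G(w):w\in N_G(v)\}\!\!\}:v\in V(G)\}\!\!\}$, where $N_G(v)$ is the neighborhood and $d_G(v)$ the degree of $v$. Let $[x_{k_1}]=\{x_1,\dots,x_{k_1}\}$, $[y_{k_2}]=\{y_1,\dots,y_{k_2}\}$. A $(k_1,k_2)$-configuration on $G,H$ is a pair of partial functions $\alpha\colon[x_{k_1}]\cup[y_{k_2}]\rightharpoonup V(G)$, $\beta\colon[x_{k_1}]\cup[y_{k_2}]\rightharpoonup V(H)$ with $\operatorname{dom}\alpha=\operatorname{dom}\beta$; it induces a partial isomorphism if $\alpha(z)\mapsto\beta(z)$ is a well-defined isomorphism $G[\operatorname{im}\alpha]\to H[\operatorname{im}\beta]$. The bijective $(k_1,k_2)$-pebble game $\operatorname{BP}_{(k_1,k_2)}(G,H)$ between Spoiler (S) and Duplicator (D) starts from the empty configuration. A round with current configuration $(\alpha,\beta)$: (1) S picks a pebble pair $z\in[x_{k_1}]\cup[y_{k_2}]$ with $z\in[x_{k_1}]$ or $\alpha(z)$ undefined (pairs $y_j$ are non-reusable); if no such $z$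 exists, the winning condition is checked directly; (2) D chooses a bijection $f\colon V(G)\to V(H)$ (S wins if $|V(G)|\neq|V(H)|$); (3) S chooses $w\in V(G)$; (4) the configuration becomes $(\alpha[z/w],\beta[z/f(w)])$. S wins after a round if the configuration does not induce a partial isomorphism; D wins if S never wins. -}

module Defs where

open import Data.Nat using (ℕ)
open import Data.Bool using (Bool; true; false)
open import Data.Fin using (Fin; _≟_)
open import Data.List using (List; []; _∷_; map; filterᵇ; length; allFin)
open import Data.Maybe using (Maybe; just; nothing)
open import Data.Product using (Σ; _×_; _,_)
open import Data.Unit using (⊤)
open import Data.Sum using (_⊎_; inj₁; inj₂)
open import Relation.Binary.PropositionalEquality using (_≡_)
open import Relation.Nullary using (yes; no)
open import Function.Bundles using (_⤖_; _⇔_; Bijection)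
open import Data.List.Relation.Binary.Permutation.Propositional using (_↭_; ↭-setoid)
import Data.List.Relation.Binary.Permutation.Setoid as PermS

record Graph : Set where
  field
    size  : ℕ
    adj   : Fin size → Fin size → Bool
    sym   : ∀ u v → adj u v ≡ adj v u
    irrefl : ∀ v → adj v v ≡ false
open Graph public

V : Graph → Set
V G = Fin (size G)

nbrs : (G : Graph) → V G → List (V G)
nbrs G v = filterᵇ (adj G v) (allFin (size G))

deg : (G : Graph) → V G → ℕ
deg G v = length (nbrs G v)

degSeq : Graph → List ℕ
degSeq G = map (deg G) (allFin (size G))

nbrDegSeq : Graph → List (List ℕ)
nbrDegSeq G = map (λ v → map (deg G) (nbrs G v)) (allFin (size G))

SameDegSeq : Graph → Graph → Set
SameDegSeq G H = degSeq G ↭ degSeq H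

-- multiset-of-multisets equality: permutation of the outer list,
-- with inner lists compared up to permutation
SameNbrDegSeq : Graph → Graph → Set
SameNbrDegSeq G H = PermS._↭_ (↭-setoid {A = ℕ}) (nbrDegSeq G) (nbrDegSeq H)

-- pebble pairs: inj₁ i = x_{i+1} (reusable), inj₂ j = y_{j+1} (non-reusable)
Pebble : ℕ → ℕ → Set
Pebble k₁ k₂ = Fin k₁ ⊎ Fin k₂

-- a configuration (α, β) with dom α = dom β: each pebble pair is either
-- unplaced or placed on a pair (α z, β z)
Config : ℕ → ℕ → Graph → Graph → Set
Config k₁ k₂ G H = Pebble k₁ k₂ → Maybe (V G × V H)

emptyConfig : ∀ {k₁ k₂ G H} → Config k₁ k₂ G H
emptyConfig _ = nothing

pebbleEq : ∀ {k₁ k₂} (z z' : Pebble k₁ k₂) → Bool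
pebbleEq (inj₁ i) (inj₁ j) with i ≟ j
... | yes _ = true
... | no _  = false
pebbleEq (inj₂ i) (inj₂ j) with i ≟ j
... | yes _ = true
... | no _  = false
pebbleEq _ _ = false

update : ∀ {k₁ k₂ G H} → Config k₁ k₂ G H → Pebble k₁ k₂ → V G → V H → Config k₁ k₂ G H
update c z w w' z' with pebbleEq z z'
... | true  = just (w , w')
... | false = c z'

-- α(z) ↦ β(z) is a well-defined isomorphism G[im α] → H[im β]
PartialIso : ∀ {k₁ k₂ G H} → Config k₁ k₂ G H → Set
PartialIso {G = G} {H = H} c =
  ∀ z z' a b a' b' → c z ≡ just (a , b) → c z' ≡ just (a' , b') →
    ((a ≡ a') ⇔ (b ≡ b')) × (adj G a a' ≡ adj H b b')

Legal : ∀ {k₁ k₂ G H} → Config k₁ k₂ G H → Pebble k₁ k₂ → Set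
Legal c (inj₁ _) = ⊤
Legal c (inj₂ j) = c (inj₂ j) ≡ nothing

-- history of Spoiler's moves (most recent first): chosen pebble and vertex w
History : ℕ → ℕ → Graph → Set
History k₁ k₂ G = List (Pebble k₁ k₂ × V G)

-- A Duplicator strategy: given the history and the pebble just chosen,
-- a bijection V(G) → V(H).  (None exists if |V(G)| ≠ |V(H)|.)
record Strategy (k₁ k₂ : ℕ) (G H : Graph) : Set where
  constructor strategy
  field
    choose : History k₁ k₂ G → Pebble k₁ k₂ → V G ⤖ V H
open Strategy public

data Reach {k₁ k₂ : ℕ} {G H : Graph} (σ : Strategy k₁ k₂ G H) :
       History k₁ k₂ G → Config k₁ k₂ G H → Set where
  start : Reach σ [] (emptyConfig {k₁} {k₂} {G} {H})
  step  : ∀ {h c} → Reach σ h c → (z : Pebble k₁ k₂) → Legal {k₁} {k₂} {G} {H} c z → (w : V G) →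
          Reach σ ((z , w) ∷ h) (update {k₁} {k₂} {G} {H} c z w (Bijection.to (choose σ h z) w))

Winning : ∀ {k₁ k₂ G H} → Strategy k₁ k₂ G H → Set
Winning {k₁} {k₂} {G} {H} σ = ∀ h c → Reach σ h c → PartialIso {k₁} {k₂} {G} {H} c

DupWins : ℕ → ℕ → Graph → Graph → Set
DupWins k₁ k₂ G H = Σ (Strategy k₁ k₂ G H) Winning

-- Duplicator answers the first pebble by a bijection π matching degrees (in BP(1,1):
-- multisets of neighbour degrees), and a pebble placed while another one sits on (a , b) by a
-- bijection sending a to b and preserving adjacency to a, which exists iff deg a = deg b.
-- In BP(1,1) the non-reusable y, placed while x sits on (a , π a), is answered by such a
-- bijection that also preserves degrees, so that every later move of x stays answerable.
-- These pinned bijections come from the labels t ↦ (adj a t , d t): their multisets agree on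
-- both sides (the adjacent part is the neighbour labels, the rest its complement), so some
-- bijection preserves them, and a transposition makes it send a to b.  Conversely, two
-- (resp. three) Spoiler moves read degrees (resp. neighbour degrees) off Duplicator's replies.
module Submission where

open import Level using (Level)
open import Data.Bool using (Bool; true; false; not)
open import Data.Fin using (Fin; zero; suc; punchIn)
open import Data.Fin.Permutation as Perm using (Permutation; _⟨$⟩ʳ_; _⟨$⟩ˡ_; _∘ₚ_)
import Data.Fin.Permutation.Components as PermC
open import Data.Fin.Properties using () renaming (_≟_ to _≟ᶠ_)
open import Data.List using (List; []; _∷_; _++_; map; filterᵇ; length; tabulate; lookup; allFin)
open import Data.List.Properties
  using (map-tabulate; tabulate-cong; length-tabulate; lookup-tabulate; length-map)
import Data.List.Relation.Binary.Pointwise as Pointwise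
open import Data.List.Relation.Binary.Permutation.Propositional
  using (_↭_; ↭-setoid; ↭-refl; ↭-sym; ↭-trans; ↭-prep; ↭-swap; ↭-reflexive; ↭⇒↭ₛ; ↭⇒↭ₛ′;
         module PermutationReasoning)
open import Data.List.Relation.Binary.Permutation.Propositional.Properties
  using (drop-∷; ++⁺; ++⁺ʳ; map⁺; filter-↭; shift; ↭-length)
import Data.List.Relation.Binary.Permutation.Setoid as Permₛ
import Data.List.Relation.Binary.Permutation.Setoid.Properties as Permₛ-Properties
open import Data.Maybe using (Maybe; just; nothing)
open import Data.Nat as ℕ using (ℕ; _≟_)
open import Data.Nat.Properties using (suc-injective)
open import Data.Product using (∃; _×_; _,_; proj₁; proj₂; <_,_>)
open import Data.Sum using (_⊎_; inj₁; inj₂)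
open import Data.Unit using (⊤; tt)
open import Function using (_∘_; id; const)
open import Function.Bundles using (_⇔_; mk⇔; Equivalence; Injection)
open import Function.Properties.Bijection using (⤖⇒↔)
open import Function.Properties.Inverse using (↔⇒↣; ↔⇒⤖)
open import Relation.Binary.Bundles using (Setoid)
open import Relation.Binary.PropositionalEquality as ≡
  using (_≡_; _≗_; refl; sym; trans; cong; cong₂)
import Relation.Binary.Reasoning.Setoid as SetoidReasoning
open import Relation.Nullary using (yes; no; contradiction)

open import Defs renaming (sym to adj-sym)

private variable
  a ℓ : Level
  A X Y : Set a
  n m : ℕ

++-cancelˡ-↭ : ∀ (xs : List A) {ys zs} → xs ++ ys ↭ xs ++ zs → ys ↭ zs
++-cancelˡ-↭ []       p = p
++-cancelˡ-↭ (x ∷ xs) p = ++-cancelˡ-↭ xs (drop-∷ p)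

map-filterᵇ-partition-↭ : ∀ (p : X → Bool) (f : X → A) xs →
  map f xs ↭ map f (filterᵇ p xs) ++ map f (filterᵇ (not ∘ p) xs)
map-filterᵇ-partition-↭ p f []       = ↭-refl
map-filterᵇ-partition-↭ p f (x ∷ xs) with p x
... | true  = ↭-prep (f x) (map-filterᵇ-partition-↭ p f xs)
... | false = ↭-trans (↭-prep (f x) (map-filterᵇ-partition-↭ p f xs))
                      (↭-sym (shift (f x) (map f (filterᵇ p xs)) _))

map-tagged-partition-↭ : ∀ (p : X → Bool) (f : X → A) xs →
  map < p , f > xs ↭
    map (true ,_) (map f (filterᵇ p xs)) ++ map (false ,_) (map f (filterᵇ (not ∘ p) xs))
map-tagged-partition-↭ p f []       = ↭-refl
map-tagged-partition-↭ p f (x ∷ xs) with p x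
... | true  = ↭-prep (true , f x) (map-tagged-partition-↭ p f xs)
... | false = ↭-trans (↭-prep (false , f x) (map-tagged-partition-↭ p f xs))
                      (↭-sym (shift (false , f x) (map (true ,_) (map f (filterᵇ p xs))) _))

map-filterᵇ-by-tags : ∀ (p : X → Bool) (f : X → A) xs →
  map f (filterᵇ p xs) ≡ map proj₂ (filterᵇ proj₁ (map < p , f > xs))
map-filterᵇ-by-tags p f []       = refl
map-filterᵇ-by-tags p f (x ∷ xs) with p x
... | true  = cong (f x ∷_) (map-filterᵇ-by-tags p f xs)
... | false = map-filterᵇ-by-tags p f xs

-- The false-tagged part is recovered by cancelling the true-tagged part from the whole.
map-tagged-↭ : ∀ {xs : List X} {ys : List Y} (p : X → Bool) (q : Y → Bool) (f : X → A) (g : Y → A) →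
  map f xs ↭ map g ys → map f (filterᵇ p xs) ↭ map g (filterᵇ q ys) →
  map < p , f > xs ↭ map < q , g > ys
map-tagged-↭ {xs = xs} {ys} p q f g all↭ true↭ = begin
  map < p , f > xs                      ↭⟨ map-tagged-partition-↭ p f xs ⟩
  map (true ,_) Tₓ ++ map (false ,_) Fₓ ↭⟨ ++⁺ (map⁺ (true ,_) true↭) (map⁺ (false ,_) false↭) ⟩
  map (true ,_) Tᵧ ++ map (false ,_) Fᵧ ↭⟨ map-tagged-partition-↭ q g ys ⟨
  map < q , g > ys                      ∎
  where
  open PermutationReasoning
  Tₓ = map f (filterᵇ p xs)
  Fₓ = map f (filterᵇ (not ∘ p) xs)
  Tᵧ = map g (filterᵇ q ys)
  Fᵧ = map g (filterᵇ (not ∘ q) ys)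
  false↭ : Fₓ ↭ Fᵧ
  false↭ = ++-cancelˡ-↭ Tₓ (begin
    Tₓ ++ Fₓ  ↭⟨ map-filterᵇ-partition-↭ p f xs ⟨
    map f xs  ↭⟨ all↭ ⟩
    map g ys  ↭⟨ map-filterᵇ-partition-↭ q g ys ⟩
    Tᵧ ++ Fᵧ  ↭⟨ ++⁺ʳ Fᵧ true↭ ⟨
    Tₓ ++ Fᵧ  ∎)

map-const-↭ : ∀ (x : A) {xs : List X} {ys : List Y} → length xs ≡ length ys →
  map (const x) xs ↭ map (const x) ys
map-const-↭ x {[]}     {[]}     _ = ↭-refl
map-const-↭ x {_ ∷ xs} {_ ∷ ys} e = ↭-prep x (map-const-↭ x (suc-injective e))

tabulate-punchIn-↭ : ∀ (f : Fin (ℕ.suc n) → A) i → tabulate f ↭ f i ∷ tabulate (f ∘ punchIn i)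
tabulate-punchIn-↭ f zero = ↭-refl
tabulate-punchIn-↭ {n = ℕ.suc n} f (suc i) =
  ↭-trans (↭-prep (f zero) (tabulate-punchIn-↭ (f ∘ suc) i)) (↭-swap _ _ ↭-refl)

tabulate-permute-↭ : ∀ (π : Permutation n m) (f : Fin m → A) → tabulate (f ∘ (π ⟨$⟩ʳ_)) ↭ tabulate f
tabulate-permute-↭ {ℕ.zero}  {ℕ.zero}  π f = ↭-refl
tabulate-permute-↭ {ℕ.zero}  {ℕ.suc m} π f with π ⟨$⟩ˡ zero
... | ()
tabulate-permute-↭ {ℕ.suc n} {ℕ.zero}  π f with π ⟨$⟩ʳ zero
... | ()
tabulate-permute-↭ {ℕ.suc n} {ℕ.suc m} π f = begin
  f (π ⟨$⟩ʳ zero) ∷ tabulate (f ∘ (π ⟨$⟩ʳ_) ∘ suc)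
    ≡⟨ cong (f (π ⟨$⟩ʳ zero) ∷_) (tabulate-cong (cong f ∘ Perm.punchIn-permute π zero)) ⟩
  f (π ⟨$⟩ʳ zero) ∷ tabulate (f ∘ punchIn (π ⟨$⟩ʳ zero) ∘ (Perm.remove zero π ⟨$⟩ʳ_))
    ↭⟨ ↭-prep _ (tabulate-permute-↭ (Perm.remove zero π) (f ∘ punchIn (π ⟨$⟩ʳ zero))) ⟩
  f (π ⟨$⟩ʳ zero) ∷ tabulate (f ∘ punchIn (π ⟨$⟩ʳ zero))
    ↭⟨ tabulate-punchIn-↭ f (π ⟨$⟩ʳ zero) ⟨
  tabulate f ∎
  where open PermutationReasoning

module Setoidal {c ℓ} (S : Setoid c ℓ) where
  open Setoid S using (_≈_; isEquivalence) renaming (Carrier to C)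
  open Permₛ S using (onIndices)
    renaming (_↭_ to _↭ₛ_; ↭-reflexive to ↭ₛ-reflexive; refl to ↭ₛ-reflexive-≋; trans to ↭ₛ-trans)
  open Permₛ-Properties S using (onIndices-lookup)

  permutation⇒allFin-↭ : ∀ {f : Fin n → C} {g : Fin m → C} (π : Permutation n m) →
    (∀ i → f i ≈ g (π ⟨$⟩ʳ i)) → map f (allFin n) ↭ₛ map g (allFin m)
  permutation⇒allFin-↭ {f = f} {g} π f≈gπ =
    ↭ₛ-trans (↭ₛ-reflexive (map-tabulate id f)) (↭ₛ-trans
      (↭ₛ-reflexive-≋ (Pointwise.tabulate⁺ f≈gπ))
      (↭⇒↭ₛ′ isEquivalence (↭-trans (tabulate-permute-↭ π g) (↭-reflexive (sym (map-tabulate id g))))))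

  allFin-↭⇒permutation : ∀ {f : Fin n → C} {g : Fin m → C} → map f (allFin n) ↭ₛ map g (allFin m) →
    ∃ λ (π : Permutation n m) → ∀ i → f i ≈ g (π ⟨$⟩ʳ i)
  allFin-↭⇒permutation {n = n} {m = m} {f = f} {g = g} f↭g = π , f≈gπ
    where
    open SetoidReasoning S
    tabulate↭ : tabulate f ↭ₛ tabulate g
    tabulate↭ = ↭ₛ-trans (↭ₛ-reflexive (sym (map-tabulate id f)))
                         (↭ₛ-trans f↭g (↭ₛ-reflexive (map-tabulate id g)))
    indexᶠ : Permutation n (length (tabulate f))
    indexᶠ = Perm.cast-id (sym (length-tabulate f))
    indexᵍ : Permutation m (length (tabulate g))
    indexᵍ = Perm.cast-id (sym (length-tabulate g))
    π : Permutation n m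
    π = indexᶠ ∘ₚ onIndices tabulate↭ ∘ₚ Perm.flip indexᵍ
    f≈gπ : ∀ i → f i ≈ g (π ⟨$⟩ʳ i)
    f≈gπ i = begin
      f i                                        ≡⟨ lookup-tabulate f i ⟨
      lookup (tabulate f) (indexᶠ ⟨$⟩ʳ i)         ≈⟨ onIndices-lookup tabulate↭ _ ⟩
      lookup (tabulate g) j                      ≡⟨ cong (lookup (tabulate g)) (Perm.inverseʳ indexᵍ) ⟨
      lookup (tabulate g) (indexᵍ ⟨$⟩ʳ (indexᵍ ⟨$⟩ˡ j)) ≡⟨ lookup-tabulate g _ ⟩
      g (π ⟨$⟩ʳ i)                                ∎
      where j = onIndices tabulate↭ ⟨$⟩ʳ (indexᶠ ⟨$⟩ʳ i)

allFin-↭⇒permutation : ∀ {f : Fin n → A} {g : Fin m → A} → map f (allFin n) ↭ map g (allFin m) →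
  ∃ λ (π : Permutation n m) → f ≗ g ∘ (π ⟨$⟩ʳ_)
allFin-↭⇒permutation f↭g = Setoidal.allFin-↭⇒permutation (≡.setoid _) (↭⇒↭ₛ f↭g)

permutation⇒allFin-↭ : ∀ {f : Fin n → A} {g : Fin m → A} (π : Permutation n m) →
  f ≗ g ∘ (π ⟨$⟩ʳ_) → map f (allFin n) ↭ map g (allFin m)
permutation⇒allFin-↭ {f = f} {g} π f≗gπ = begin
  map f (allFin _)       ≡⟨ map-tabulate id f ⟩
  tabulate f             ≡⟨ tabulate-cong f≗gπ ⟩
  tabulate (g ∘ (π ⟨$⟩ʳ_)) ↭⟨ tabulate-permute-↭ π g ⟩
  tabulate g             ≡⟨ map-tabulate id g ⟨
  map g (allFin _)       ∎
  where open PermutationReasoning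

filterᵇ-permutation-↭ : ∀ {p : Fin n → Bool} {q : Fin m → Bool} {f : Fin n → A} {g : Fin m → A}
  (π : Permutation n m) → p ≗ q ∘ (π ⟨$⟩ʳ_) → f ≗ g ∘ (π ⟨$⟩ʳ_) →
  map f (filterᵇ p (allFin n)) ↭ map g (filterᵇ q (allFin m))
filterᵇ-permutation-↭ {n = n} {m = m} {p = p} {q} {f} {g} π p≗qπ f≗gπ = begin
  map f (filterᵇ p (allFin n))                          ≡⟨ map-filterᵇ-by-tags p f (allFin n) ⟩
  map proj₂ (filterᵇ proj₁ (map < p , f > (allFin n)))  ↭⟨ map⁺ proj₂ (filter-↭ _ tagged↭) ⟩
  map proj₂ (filterᵇ proj₁ (map < q , g > (allFin m)))  ≡⟨ map-filterᵇ-by-tags q g (allFin m) ⟨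
  map g (filterᵇ q (allFin m))                          ∎
  where
  open PermutationReasoning
  tagged↭ : map < p , f > (allFin n) ↭ map < q , g > (allFin m)
  tagged↭ = permutation⇒allFin-↭ π (λ i → cong₂ _,_ (p≗qπ i) (f≗gπ i))

transpose-fixes : ∀ (f : Fin n → A) {i j} → f i ≡ f j → f ∘ PermC.transpose i j ≗ f
transpose-fixes f {i} {j} fi≡fj k with k ≟ᶠ i
... | yes refl = sym fi≡fj
... | no _ with k ≟ᶠ j
...   | yes refl = fi≡fj
...   | no _     = refl

transpose-source : ∀ (i j : Fin n) → PermC.transpose i j i ≡ j
transpose-source i j with i ≟ᶠ i
... | yes _  = refl
... | no i≢i = contradiction refl i≢i

pin-permutation : ∀ {f : Fin n → A} {g : Fin m → A} (π : Permutation n m) → f ≗ g ∘ (π ⟨$⟩ʳ_) →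
  ∀ {i j} → f i ≡ g j → ∃ λ (ρ : Permutation n m) → ρ ⟨$⟩ʳ i ≡ j × f ≗ g ∘ (ρ ⟨$⟩ʳ_)
pin-permutation {n = n} {m = m} {f = f} {g} π f≗gπ {i} {j} fi≡gj = ρ , ρi≡j , f≗gρ
  where
  i′ : Fin n
  i′ = π ⟨$⟩ˡ j
  ρ : Permutation n m
  ρ = Perm.transpose i i′ ∘ₚ π
  ρi≡j : ρ ⟨$⟩ʳ i ≡ j
  ρi≡j = trans (cong (π ⟨$⟩ʳ_) (transpose-source i i′)) (Perm.inverseʳ π)
  fi≡fi′ : f i ≡ f i′
  fi≡fi′ = trans fi≡gj (trans (cong g (sym (Perm.inverseʳ π))) (sym (f≗gπ i′)))
  f≗gρ : f ≗ g ∘ (ρ ⟨$⟩ʳ_)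
  f≗gρ k = trans (sym (transpose-fixes f fi≡fi′ k)) (f≗gπ _)

module _ (G H : Graph) where

  Compatible : V G × V H → V G × V H → Set
  Compatible (a , b) (a′ , b′) = ((a ≡ a′) ⇔ (b ≡ b′)) × (adj G a a′ ≡ adj H b b′)

  no-loops : ∀ u u′ → adj G u u ≡ adj H u′ u′
  no-loops u u′ = trans (irrefl G u) (sym (irrefl H u′))

  compatible-refl : ∀ x → Compatible x x
  compatible-refl (a , b) = mk⇔ (λ _ → refl) (λ _ → refl) , no-loops a b

  compatible-sym : ∀ {x y} → Compatible x y → Compatible y x
  compatible-sym (a≡a′⇔b≡b′ , adj≡) =
    mk⇔ (sym ∘ to ∘ sym) (sym ∘ from ∘ sym) , trans (adj-sym G _ _) (trans adj≡ (adj-sym H _ _))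
    where open Equivalence a≡a′⇔b≡b′

  same-placement : ∀ {m : Maybe (V G × V H)} {x y} → m ≡ just x → m ≡ just y → Compatible x y
  same-placement refl refl = compatible-refl _

  deg-permutation-≡ : ∀ {u u′} (π : Permutation (size G) (size H)) →
    (∀ t → adj G u t ≡ adj H u′ (π ⟨$⟩ʳ t)) → deg G u ≡ deg H u′
  deg-permutation-≡ {u} {u′} π adj≡ = begin
    deg G u                             ≡⟨ length-map (const tt) (nbrs G u) ⟨
    length (map (const tt) (nbrs G u))  ≡⟨ ↭-length (filterᵇ-permutation-↭ π adj≡ λ _ → refl) ⟩
    length (map (const tt) (nbrs H u′)) ≡⟨ length-map (const tt) (nbrs H u′) ⟩
    deg H u′                            ∎
    where open ≡.≡-Reasoning

  nbrDegrees-↭⇒deg-≡ : ∀ {u u′} → map (deg G) (nbrs G u) ↭ map (deg H) (nbrs H u′) → deg G u ≡ deg H u′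
  nbrDegrees-↭⇒deg-≡ {u} {u′} p =
    trans (sym (length-map (deg G) (nbrs G u))) (trans (↭-length p) (length-map (deg H) (nbrs H u′)))

  record Pinned {A : Set a} (dG : V G → A) (dH : V H → A) (u : V G) (u′ : V H) : Set a where
    field
      perm   : Permutation (size G) (size H)
      pinned : perm ⟨$⟩ʳ u ≡ u′
      adj-≡  : ∀ t → adj G u t ≡ adj H u′ (perm ⟨$⟩ʳ t)
      labels : dG ≗ dH ∘ (perm ⟨$⟩ʳ_)

    compatible : ∀ w → Compatible (u , u′) (w , perm ⟨$⟩ʳ w)
    compatible w = mk⇔ (λ { refl → sym pinned }) (λ u′≡ → injective (trans pinned u′≡)) , adj-≡ w
      where open Injection (↔⇒↣ perm) using (injective)

  pin : ∀ {dG : V G → A} {dH : V H → A} (π : Permutation (size G) (size H)) → dG ≗ dH ∘ (π ⟨$⟩ʳ_) →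
    ∀ {u u′} → dG u ≡ dH u′ → map dG (nbrs G u) ↭ map dH (nbrs H u′) → Pinned dG dH u u′
  pin {dG = dG} {dH} π dG≗dHπ {u} {u′} du≡du′ nbrs↭
    with ρ₀ , tags≡₀ ← allFin-↭⇒permutation
                         (map-tagged-↭ (adj G u) (adj H u′) dG dH (permutation⇒allFin-↭ π dG≗dHπ) nbrs↭)
    with ρ , ρu≡u′ , tags≡ ← pin-permutation {f = < adj G u , dG >} {< adj H u′ , dH >} ρ₀ tags≡₀
                                             (cong₂ _,_ (no-loops u u′) du≡du′)
    = record { perm = ρ ; pinned = ρu≡u′ ; adj-≡ = cong proj₁ ∘ tags≡ ; labels = cong proj₂ ∘ tags≡ }

  -- The permutation argument only witnesses |V G| = |V H|.
  pin-by-degree : Permutation (size G) (size H) →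
    ∀ {u u′} → deg G u ≡ deg H u′ → Pinned (const tt) (const tt) u u′
  pin-by-degree π du≡du′ = pin π (λ _ → refl) refl (map-const-↭ tt du≡du′)

module Positional {k₁ k₂ : ℕ} (G H : Graph)
                  (next : Config k₁ k₂ G H → Pebble k₁ k₂ → Permutation (size G) (size H)) where

  move : Config k₁ k₂ G H → Pebble k₁ k₂ → V G → Config k₁ k₂ G H
  move c z w = update {k₁} {k₂} {G} {H} c z w (next c z ⟨$⟩ʳ w)

  replay : History k₁ k₂ G → Config k₁ k₂ G H
  replay []            = emptyConfig {k₁} {k₂} {G} {H}
  replay ((z , w) ∷ h) = move (replay h) z w

  positional : Strategy k₁ k₂ G H
  positional = strategy λ h z → ↔⇒⤖ (next (replay h) z)

  reach⇒replay : ∀ {h c} → Reach positional h c → c ≡ replay h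
  reach⇒replay start = refl
  reach⇒replay (step r z _ w) with refl ← reach⇒replay r = refl

  reachable-invariant : ∀ (I : Config k₁ k₂ G H → Set ℓ) → I (emptyConfig {k₁} {k₂} {G} {H}) →
    (∀ c z → Legal {k₁} {k₂} {G} {H} c z → ∀ w → I c → I (move c z w)) →
    ∀ {h c} → Reach positional h c → I c
  reachable-invariant I I-empty I-move start = I-empty
  reachable-invariant I I-empty I-move (step r z legal w) with refl ← reach⇒replay r =
    I-move _ z legal w (reachable-invariant I I-empty I-move r)

module _ {k₁ k₂ : ℕ} (G H : Graph) where

  partialIso-of-pair : ∀ (p q : Pebble k₁ k₂) → (∀ z → z ≡ p ⊎ z ≡ q) → (c : Config k₁ k₂ G H) →
    (∀ {x y} → c p ≡ just x → c q ≡ just y → Compatible G H x y) → PartialIso {k₁} {k₂} {G} {H} c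
  partialIso-of-pair p q cover c pq-compatible z z′ a b a′ b′ cz cz′ with cover z | cover z′
  ... | inj₁ refl | inj₁ refl = same-placement G H cz cz′
  ... | inj₁ refl | inj₂ refl = pq-compatible cz cz′
  ... | inj₂ refl | inj₁ refl = compatible-sym G H (pq-compatible cz′ cz)
  ... | inj₂ refl | inj₂ refl = same-placement G H cz cz′

module _ (G H : Graph) (π : Permutation (size G) (size H)) where

  adjacencyReply : Maybe (V G × V H) → Permutation (size G) (size H)
  adjacencyReply nothing = π
  adjacencyReply (just (a , b)) with deg G a ≟ deg H b
  ... | yes da≡db = Pinned.perm (pin-by-degree G H π da≡db)
  ... | no _      = π

  adjacencyReply-compatible : ∀ {a b} → deg G a ≡ deg H b →
    ∀ w → Compatible G H (a , b) (w , adjacencyReply (just (a , b)) ⟨$⟩ʳ w)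
  adjacencyReply-compatible {a} {b} da≡db w with deg G a ≟ deg H b
  ... | yes da≡db′ = Pinned.compatible (pin-by-degree G H π da≡db′) w
  ... | no da≢db   = contradiction da≡db da≢db

module Game₀₂ where

  y₁ y₂ : Pebble 0 2
  y₁ = inj₂ zero
  y₂ = inj₂ (suc zero)

  module Duplicator (G H : Graph) (π : Permutation (size G) (size H))
                    (π-deg : deg G ≗ deg H ∘ (π ⟨$⟩ʳ_)) where

    next : Config 0 2 G H → Pebble 0 2 → Permutation (size G) (size H)
    next c (inj₂ zero)       = adjacencyReply G H π (c y₂)
    next c (inj₂ (suc zero)) = adjacencyReply G H π (c y₁)

    open Positional G H next public

    Invariant : Maybe (V G × V H) → Maybe (V G × V H) → Set
    Invariant nothing        nothing        = ⊤
    Invariant (just (a , b)) nothing        = deg G a ≡ deg H b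
    Invariant nothing        (just (a , b)) = deg G a ≡ deg H b
    Invariant (just x)       (just y)       = Compatible G H x y

    place-y₁ : ∀ m → Invariant nothing m → ∀ w → Invariant (just (w , adjacencyReply G H π m ⟨$⟩ʳ w)) m
    place-y₁ nothing  _     w = π-deg w
    place-y₁ (just _) da≡db w = compatible-sym G H (adjacencyReply-compatible G H π da≡db w)

    place-y₂ : ∀ m → Invariant m nothing → ∀ w → Invariant m (just (w , adjacencyReply G H π m ⟨$⟩ʳ w))
    place-y₂ nothing  _     w = π-deg w
    place-y₂ (just _) da≡db w = adjacencyReply-compatible G H π da≡db w

    invariant-move : ∀ c z → Legal {0} {2} {G} {H} c z → ∀ w →
      Invariant (c y₁) (c y₂) → Invariant (move c z w y₁) (move c z w y₂)
    invariant-move c (inj₂ zero)       y₁-free w inv =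
      place-y₁ (c y₂) (≡.subst (λ m → Invariant m (c y₂)) y₁-free inv) w
    invariant-move c (inj₂ (suc zero)) y₂-free w inv =
      place-y₂ (c y₁) (≡.subst (Invariant (c y₁)) y₂-free inv) w

    invariant-compatible : ∀ {m m′ x y} → Invariant m m′ → m ≡ just x → m′ ≡ just y → Compatible G H x y
    invariant-compatible inv refl refl = inv

    cover : ∀ z → z ≡ y₁ ⊎ z ≡ y₂
    cover (inj₂ zero)       = inj₁ refl
    cover (inj₂ (suc zero)) = inj₂ refl

    winning : Winning positional
    winning h c r = partialIso-of-pair G H y₁ y₂ cover c (invariant-compatible invariant)
      where
      invariant : Invariant (c y₁) (c y₂)
      invariant = reachable-invariant (λ c → Invariant (c y₁) (c y₂)) tt invariant-move r

  winning-of-degSeq : ∀ G H → SameDegSeq G H → DupWins 0 2 G H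
  winning-of-degSeq G H degs↭ with π , π-deg ← allFin-↭⇒permutation degs↭ =
    Duplicator.positional G H π π-deg , Duplicator.winning G H π π-deg

  degSeq-of-winning : ∀ G H → DupWins 0 2 G H → SameDegSeq G H
  degSeq-of-winning G H (σ , win) = permutation⇒allFin-↭ π λ u → deg-permutation-≡ G H (g u) (adj-kept u)
    where
    π : Permutation (size G) (size H)
    π = ⤖⇒↔ (choose σ [] y₁)
    g : V G → Permutation (size G) (size H)
    g u = ⤖⇒↔ (choose σ ((y₁ , u) ∷ []) y₂)
    adj-kept : ∀ u t → adj G u t ≡ adj H (π ⟨$⟩ʳ u) (g u ⟨$⟩ʳ t)
    adj-kept u t = proj₂ (win _ _ (step (step start y₁ refl u) y₂ refl t) y₁ y₂ _ _ _ _ refl refl)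

module Game₁₁ where

  x y : Pebble 1 1
  x = inj₁ zero
  y = inj₂ zero

  module Duplicator (G H : Graph) (π : Permutation (size G) (size H))
                    (π-nbrDeg : ∀ t → map (deg G) (nbrs G t) ↭ map (deg H) (nbrs H (π ⟨$⟩ʳ t))) where

    π-deg : deg G ≗ deg H ∘ (π ⟨$⟩ʳ_)
    π-deg t = nbrDegrees-↭⇒deg-≡ G H (π-nbrDeg t)

    pinned : ∀ a → Pinned G H (deg G) (deg H) a (π ⟨$⟩ʳ a)
    pinned a = pin G H π π-deg (π-deg a) (π-nbrDeg a)

    adjacencyDegreeReply : Maybe (V G × V H) → Permutation (size G) (size H)
    adjacencyDegreeReply nothing        = π
    adjacencyDegreeReply (just (a , _)) = Pinned.perm (pinned a)

    next : Config 1 1 G H → Pebble 1 1 → Permutation (size G) (size H)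
    next c (inj₁ _) = adjacencyReply G H π (c y)
    next c (inj₂ _) = adjacencyDegreeReply (c x)

    open Positional G H next public

    -- While y is free, x sits on some (a , π a), where π matches neighbourhood degrees.
    Invariant : Maybe (V G × V H) → Maybe (V G × V H) → Set
    Invariant nothing        nothing         = ⊤
    Invariant (just (a , b)) nothing         = b ≡ π ⟨$⟩ʳ a
    Invariant nothing        (just (a′ , b′)) = deg G a′ ≡ deg H b′
    Invariant (just p)       (just (a′ , b′)) = deg G a′ ≡ deg H b′ × Compatible G H p (a′ , b′)

    y-degrees : ∀ m {a′ b′} → Invariant m (just (a′ , b′)) → deg G a′ ≡ deg H b′
    y-degrees nothing  da′≡db′       = da′≡db′
    y-degrees (just _) (da′≡db′ , _) = da′≡db′

    place-x : ∀ m m′ → Invariant m m′ → ∀ w → Invariant (just (w , adjacencyReply G H π m′ ⟨$⟩ʳ w)) m′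
    place-x m nothing          _   w = refl
    place-x m (just (a′ , b′)) inv w =
      da′≡db′ , compatible-sym G H (adjacencyReply-compatible G H π da′≡db′ w)
      where
      da′≡db′ : deg G a′ ≡ deg H b′
      da′≡db′ = y-degrees m inv

    place-y : ∀ m → Invariant m nothing → ∀ w → Invariant m (just (w , adjacencyDegreeReply m ⟨$⟩ʳ w))
    place-y nothing        _    w = π-deg w
    place-y (just (a , _)) refl w = Pinned.labels (pinned a) w , Pinned.compatible (pinned a) w

    invariant-move : ∀ c z → Legal {1} {1} {G} {H} c z → ∀ w →
      Invariant (c x) (c y) → Invariant (move c z w x) (move c z w y)
    invariant-move c (inj₁ zero) _      w inv = place-x (c x) (c y) inv w
    invariant-move c (inj₂ zero) y-free w inv = place-y (c x) (≡.subst (Invariant (c x)) y-free inv) w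

    invariant-compatible : ∀ {m m′ p q} → Invariant m m′ → m ≡ just p → m′ ≡ just q → Compatible G H p q
    invariant-compatible (_ , compatible) refl refl = compatible

    cover : ∀ z → z ≡ x ⊎ z ≡ y
    cover (inj₁ zero) = inj₁ refl
    cover (inj₂ zero) = inj₂ refl

    winning : Winning positional
    winning h c r = partialIso-of-pair G H x y cover c (invariant-compatible invariant)
      where
      invariant : Invariant (c x) (c y)
      invariant = reachable-invariant (λ c → Invariant (c x) (c y)) tt invariant-move r

  winning-of-nbrDegSeq : ∀ G H → SameNbrDegSeq G H → DupWins 1 1 G H
  winning-of-nbrDegSeq G H nbrDegs↭ with π , π-nbrDeg ← Setoidal.allFin-↭⇒permutation ↭-setoid nbrDegs↭ =
    Duplicator.positional G H π π-nbrDeg , Duplicator.winning G H π π-nbrDeg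

  nbrDegSeq-of-winning : ∀ G H → DupWins 1 1 G H → SameNbrDegSeq G H
  nbrDegSeq-of-winning G H (σ , win) = Setoidal.permutation⇒allFin-↭ ↭-setoid π λ u →
    filterᵇ-permutation-↭ (g u) (adj-kept u) λ t → deg-permutation-≡ G H (h u t) (adj-kept′ u t)
    where
    π : Permutation (size G) (size H)
    π = ⤖⇒↔ (choose σ [] x)
    g : V G → Permutation (size G) (size H)
    g u = ⤖⇒↔ (choose σ ((x , u) ∷ []) y)
    h : V G → V G → Permutation (size G) (size H)
    h u t = ⤖⇒↔ (choose σ ((y , t) ∷ (x , u) ∷ []) x)
    adj-kept : ∀ u t → adj G u t ≡ adj H (π ⟨$⟩ʳ u) (g u ⟨$⟩ʳ t)
    adj-kept u t = proj₂ (win _ _ (step (step start x tt u) y refl t) x y _ _ _ _ refl refl)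
    adj-kept′ : ∀ u t s → adj G t s ≡ adj H (g u ⟨$⟩ʳ t) (h u t ⟨$⟩ʳ s)
    adj-kept′ u t s =
      proj₂ (win _ _ (step (step (step start x tt u) y refl t) x tt s) y x _ _ _ _ refl refl)

lemma7 : (G H : Graph) →
    (DupWins 0 2 G H ⇔ SameDegSeq G H) × (DupWins 1 1 G H ⇔ SameNbrDegSeq G H)
lemma7 G H =
  mk⇔ (Game₀₂.degSeq-of-winning G H) (Game₀₂.winning-of-degSeq G H) ,
  mk⇔ (Game₁₁.nbrDegSeq-of-winning G H) (Game₁₁.winning-of-nbrDegSeq G H)
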